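{- Let $NC$ be an initial neuronal circuit satisfying $\mathit{NegativeLoop}(NC)$, with neurons $N_0,N_1$ (identifiers $0,1$). Assume $w_{N_0}(2)\ge\tau_{N_0}$, $w_{N_1}(0)\ge\tau_{N_1}$ and $w_{N_0}(1)=-w_{N_0}(2)$. Let $\mathit{inp}$ be an external input sequence (list of booleans) all of whose entries are $1$. Then $$output_{NC}(N_0,\mathit{inp})=\mathit{repeat\_pattern}([0;1;1;0],|\mathit{inp}|+1)\quad\text{and}\quad output_{NC}(N_1,\mathit{inp})=\mathit{repeat\_pattern}([0;0;1;1],|\mathit{inp}|+1).$$
   Context: Booleans are identified with $0$ (false) and $1$ (true). A neuron $N$ consists of an identifier $id_N\in\mathbb{N}$, a weight function $w_N:\mathbb{N}\to\mathbb{Q}$ with $-1\le w_N(x)\le 1$ for all $x$ and $w_N(id_N)=0$, a leak factor $lk_N\in\mathbb{Q}$ with $0\le lk_N\le 1$, a threshold $\tau_N\in\mathbb{Q}$ with $\tau_N>0$, an output list $Output(N)$ of booleans (most recent first) and a current potential $CurPot(N)\in\mathbb{Q}$, subject to: $(\tau_N\le CurPot(N))$ equals the head of $Output(N)$ (the head of an empty list being $0$). An input function is a map $i:\mathbb{N}\to\{0,1\}$; $potential(w,i,len)=\sum_{0\le k<len,\ i(k)=1} w(k)$. The one-step update of $N$ with input function $i$ in an environment of $len$ neurons keeps $id,w,lk,\tau$, sets the new potential $p=potential(w_N,i,len)$ if $\tau_N\le CurPot(N)$ and $p=potential(w_N,i,len)+lk_N\cdot CurPot(N)$ otherwise, and sets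 the new output list to $(\tau_N\le p)::Output(N)$. A neuron is initial if its output list is $[0]$ and its current potential is $0$. A neuronal circuit $NC$ consists of a time $t_{NC}$, a list $ln_{NC}$ of neurons with pairwise distinct identifiers all $<|ln_{NC}|$ and all output lists of length $t_{NC}+1$, and a number $si_{NC}$ of external sources, with identifiers $|ln_{NC}|,\dots,L-1$, $L=|ln_{NC}|+si_{NC}$. One step of $NC$ on an external input function $e$ replaces each neuron $N$ by its one-step update in an environment of $L$ neurons with input function $x\mapsto$ (head of the output list, before the step, of the circuit neuron with identifier $x$ if $x<|ln_{NC}|$; $e(x)$ otherwise), and increments the time. A list of external inputs (most recent first) is processed from its last element to its first. $output_{NC}(N,\mathit{inp})$ is the output list of the neuron with identifier $id_N$ after processing $\mathit{inp}$. $NC$ is initial if all its neurons are initial. When $si_{NC}=1$, an external input sequence is a list of booleans, each giving the value supplied by the unique external source at that step. $\mathit{NegativeLoop}(NC)$ means: $si_{NC}=1$, $|ln_{NC}|=2$, the neuron with identifier $0$ has $w(1)<0$ and $w(2)>0$, and the neuron with identifier $1$ has $w(0)>0$ and $w(2)=0$ (the external source has identifier $2$). For a nonempty list $l=[l_0;\dots;l_{r-1}]$, $\mathit{repeat\_pattern}(l,k)=[x_{k-1};\dots;x_1;x_0]$ with $x_j=l_{j\bmod r}$ (e.g. $\mathit{repeat\_pattern}([1;0],3)=[1;0;1]$). -}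

module Defs where

open import Data.Bool using (Bool; true; false; if_then_else_)
open import Data.Nat as ℕ using (ℕ; zero; suc)
open import Data.Nat.DivMod using (m%n<n)
open import Data.Fin using (fromℕ<)
open import Data.Rational using (ℚ; 0ℚ; 1ℚ; -_; _+_; _*_; _≤_; _<_; _≤?_)
open import Data.List using (List; []; _∷_; length; map)
open import Data.List.Properties using (map-∘; length-map)
open import Data.List.Relation.Unary.All as All using (All)
open import Data.List.Relation.Unary.All.Properties as AllP using ()
open import Data.List.Relation.Unary.Unique.Propositional using (Unique)
open import Data.Maybe using (Maybe; just; nothing)
open import Data.Product using (_×_)
open import Relation.Nullary using (does)
open import Relation.Binary.PropositionalEquality using (_≡_; refl; sym; subst; cong)

head0 : List Bool → Bool
head0 []      = false
head0 (b ∷ _) = b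

record Neuron : Set where
  field
    id       : ℕ
    w        : ℕ → ℚ
    w-bounds : ∀ x → (- 1ℚ ≤ w x) × (w x ≤ 1ℚ)
    w-self   : w id ≡ 0ℚ
    lk       : ℚ
    lk-bounds : (0ℚ ≤ lk) × (lk ≤ 1ℚ)
    τ        : ℚ
    τ-pos    : 0ℚ < τ
    Output   : List Bool       -- most recent first
    CurPot   : ℚ
    inv      : does (τ ≤? CurPot) ≡ head0 Output

open Neuron public

potential : (ℕ → ℚ) → (ℕ → Bool) → ℕ → ℚ
potential w i zero    = 0ℚ
potential w i (suc n) = potential w i n + (if i n then w n else 0ℚ)

NextPot : Neuron → (ℕ → Bool) → ℕ → ℚ
NextPot N i len =
  if does (τ N ≤? CurPot N)
  then potential (w N) i len
  else potential (w N) i len + lk N * CurPot N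

NextNeuron : Neuron → (ℕ → Bool) → ℕ → Neuron
NextNeuron N i len = record
  { id = id N ; w = w N ; w-bounds = w-bounds N ; w-self = w-self N
  ; lk = lk N ; lk-bounds = lk-bounds N ; τ = τ N ; τ-pos = τ-pos N
  ; Output = does (τ N ≤? NextPot N i len) ∷ Output N
  ; CurPot = NextPot N i len
  ; inv = refl }

IsInitialNeuron : Neuron → Set
IsInitialNeuron N = (Output N ≡ false ∷ []) × (CurPot N ≡ 0ℚ)

record Circuit : Set where
  field
    time    : ℕ
    ln      : List Neuron
    si      : ℕ
    ids-distinct : Unique (map id ln)
    ids-bound    : All (λ N → id N ℕ.< length ln) ln
    out-length   : All (λ N → length (Output N) ≡ suc time) ln

open Circuit public

findNeuron : ℕ → List Neuron → Maybe Neuron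
findNeuron x [] = nothing
findNeuron x (N ∷ ns) = if does (x ℕ.≟ id N) then just N else findNeuron x ns

headOutputOf : ℕ → List Neuron → Bool
headOutputOf x ns with findNeuron x ns
... | just N  = head0 (Output N)
... | nothing = false

StepInput : Circuit → (ℕ → Bool) → ℕ → Bool
StepInput C e x = if does (x ℕ.<? length (ln C)) then headOutputOf x (ln C) else e x

Step : Circuit → (ℕ → Bool) → Circuit
Step C e = record
  { time = suc (time C)
  ; ln = map (λ N → NextNeuron N i L) (ln C)
  ; si = si C
  ; ids-distinct = subst Unique (map-∘ (ln C)) (ids-distinct C)
  ; ids-bound = AllP.map⁺ (All.map (λ {N} p → subst (λ m → id N ℕ.< m) (sym (length-map _ (ln C))) p) (ids-bound C))
  ; out-length = AllP.map⁺ (All.map (λ p → cong suc p) (out-length C))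
  }
  where
  L = length (ln C) ℕ.+ si C
  i = StepInput C e

-- process a list of external input functions (most recent first),
-- from its last element to its first
Run : Circuit → List (ℕ → Bool) → Circuit
Run C []       = C
Run C (e ∷ es) = Step (Run C es) e

-- external input sequence for a circuit with a single external source:
-- each boolean is the value supplied by that source at that step
boolsToInputs : List Bool → List (ℕ → Bool)
boolsToInputs = map (λ b _ → b)

outputOf : Circuit → Neuron → List (ℕ → Bool) → List Bool
outputOf C N inp with findNeuron (id N) (ln (Run C inp))
... | just M  = Output M
... | nothing = []

IsInitialCircuit : Circuit → Set
IsInitialCircuit C = All IsInitialNeuron (ln C)

NegativeLoop : Circuit → Set
NegativeLoop C =
  (si C ≡ 1) × (length (ln C) ≡ 2) ×
  All (λ N → id N ≡ 0 → (w N 1 < 0ℚ) × (0ℚ < w N 2)) (ln C) ×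
  All (λ N → id N ≡ 1 → (0ℚ < w N 0) × (w N 2 ≡ 0ℚ)) (ln C)

-- repeat_pattern(l, k) for the nonempty list l = x ∷ xs:
-- [x_{k-1}; …; x_0] with x_j = l_{j mod |l|}
repeatPattern : (x : Bool) → List Bool → ℕ → List Bool
repeatPattern x xs zero    = []
repeatPattern x xs (suc k) =
  Data.List.lookup (x ∷ xs) (fromℕ< (m%n<n k (length (x ∷ xs)))) ∷ repeatPattern x xs k

{-# OPTIONS --safe #-}
module Submission where

-- With the source always on, neuron 0 receives w₀(2) from the source and w₀(1) = -w₀(2)
-- from neuron 1 (its self-weight being 0), so its next potential is w₀(2) ≥ τ₀ if neuron 1
-- was silent and 0 if it fired; neuron 1 only listens to neuron 0, so its next potential
-- is w₁(0) ≥ τ₁ or 0 according to whether neuron 0 fired. Every potential is thus either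
-- at threshold (and then reset) or zero, so the leak never contributes, and the pair of
-- outputs evolves by (a, b) ↦ (¬ b, a), which from (0, 0) runs through (1, 0), (1, 1),
-- (0, 1) and back.

open import Defs
open import Data.Bool using (Bool; true; false; not; if_then_else_)
open import Data.Bool.Properties using (not-involutive)
open import Data.Fin using (fromℕ<)
open import Data.List using (List; []; _∷_; length; map; lookup; applyDownFrom)
open import Data.List.Membership.Propositional using (_∈_)
open import Data.List.Properties using (length-map)
open import Data.List.Relation.Unary.All using (All; []; _∷_)
import Data.List.Relation.Unary.All as All
open import Data.List.Relation.Unary.All.Properties using (map⁻)
open import Data.List.Relation.Unary.AllPairs using (_∷_)
open import Data.List.Relation.Unary.Any using (here; there)
open import Data.List.Relation.Unary.Unique.Propositional using (Unique)
open import Data.Maybe using (just)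
import Data.Maybe as Maybe
open import Data.Nat using (ℕ; zero; suc; _+_; _<_; _<?_; _%_; s≤s; z≤n)
import Data.Nat as ℕ
open import Data.Nat.DivMod using (_mod_; m%n<n)
open import Data.Nat.Properties using (≤⇒≯; ≤-reflexive)
open import Data.Product using (_×_; _,_; proj₁; proj₂)
open import Data.Rational using (ℚ; 0ℚ; -_; _≤?_; _≤_)
import Data.Rational as ℚ
open import Data.Rational.Properties using (+-identityˡ; +-identityʳ; *-zeroʳ; +-inverseˡ; <-irrefl; <-≤-trans)
open import Data.Sum using (_⊎_; inj₁; inj₂)
open import Function using (_∘_)
open import Relation.Binary.PropositionalEquality using (_≡_; refl; sym; trans; cong; cong₂; subst; _≢_; module ≡-Reasoning)
open import Relation.Nullary using (does)
open import Relation.Nullary.Decidable using (dec-true; dec-false)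

gated : Bool → ℚ → ℚ
gated b a = if b then a else 0ℚ

-- A potential at threshold is reset and a zero potential leaks nothing, so in either case
-- the leak factor plays no role in the next potential.
LeakInert : ℚ → ℚ → Set
LeakInert τ p = τ ≤ p ⊎ p ≡ 0ℚ

NextPot-leakInert : ∀ N i len → LeakInert (τ N) (CurPot N) → NextPot N i len ≡ potential (w N) i len
NextPot-leakInert N i len (inj₁ τ≤p) rewrite dec-true (τ N ≤? CurPot N) τ≤p = refl
NextPot-leakInert N i len (inj₂ p≡0) with does (τ N ≤? CurPot N)
... | true  = refl
... | false rewrite p≡0 | *-zeroʳ (lk N) = +-identityʳ _

fires-gated : ∀ N {a} → τ N ≤ a → ∀ b → does (τ N ≤? gated b a) ≡ b
fires-gated N τ≤a true  = dec-true (τ N ≤? _) τ≤a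
fires-gated N τ≤a false = dec-false (τ N ≤? 0ℚ) (λ τ≤0 → <-irrefl refl (<-≤-trans (τ-pos N) τ≤0))

leakInert-gated : ∀ {τ a} → τ ≤ a → ∀ b → LeakInert τ (gated b a)
leakInert-gated τ≤a true  = inj₁ τ≤a
leakInert-gated τ≤a false = inj₂ refl

findNeuron-here : ∀ {x} N ns → id N ≡ x → findNeuron x (N ∷ ns) ≡ just N
findNeuron-here {x} N ns idN≡x rewrite dec-true (x ℕ.≟ id N) (sym idN≡x) = refl

findNeuron-there : ∀ {x} N ns → id N ≢ x → findNeuron x (N ∷ ns) ≡ findNeuron x ns
findNeuron-there {x} N ns idN≢x rewrite dec-false (x ℕ.≟ id N) (idN≢x ∘ sym) = refl

findNeuron-unique : ∀ {N} ns → Unique (map id ns) → N ∈ ns → findNeuron (id N) ns ≡ just N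
findNeuron-unique (M ∷ ms) (_ ∷ _)  (here refl) = findNeuron-here M ms refl
findNeuron-unique (M ∷ ms) (M∉ ∷ u) (there N∈) =
  trans (findNeuron-there M ms (All.lookup (map⁻ M∉) N∈)) (findNeuron-unique ms u N∈)

findNeuron-map-NextNeuron : ∀ x i len ns →
  findNeuron x (map (λ N → NextNeuron N i len) ns) ≡ Maybe.map (λ N → NextNeuron N i len) (findNeuron x ns)
findNeuron-map-NextNeuron x i len []       = refl
findNeuron-map-NextNeuron x i len (N ∷ ns) with does (x ℕ.≟ id N)
... | true  = refl
... | false = findNeuron-map-NextNeuron x i len ns

headOutputOf-just : ∀ x ns {X} → findNeuron x ns ≡ just X → headOutputOf x ns ≡ head0 (Output X)
headOutputOf-just x ns found with findNeuron x ns
headOutputOf-just x ns refl | just _ = refl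

outputOf-just : ∀ C N inp {X} → findNeuron (id N) (ln (Run C inp)) ≡ just X → outputOf C N inp ≡ Output X
outputOf-just C N inp found with findNeuron (id N) (ln (Run C inp))
outputOf-just C N inp refl | just _ = refl

StepInput-neuron : ∀ C e {x} → x < length (ln C) → StepInput C e x ≡ headOutputOf x (ln C)
StepInput-neuron C e {x} x<n rewrite dec-true (x <? length (ln C)) x<n = refl

StepInput-source : ∀ C e {x} → length (ln C) ℕ.≤ x → StepInput C e x ≡ e x
StepInput-source C e {x} n≤x rewrite dec-false (x <? length (ln C)) (≤⇒≯ n≤x) = refl

record Tracks (C : Circuit) (k : ℕ) (out : ℕ → Bool) (n : ℕ) (X : Neuron) : Set where
  field
    found     : findNeuron k (ln C) ≡ just X
    leakInert : LeakInert (τ X) (CurPot X)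
    history   : Output X ≡ applyDownFrom out (suc n)

open Tracks

Tracks-initial : ∀ C {N k out} → out 0 ≡ false → IsInitialCircuit C → N ∈ ln C → id N ≡ k → Tracks C k out 0 N
Tracks-initial C out₀ initial N∈ refl = record
  { found     = findNeuron-unique (ln C) (ids-distinct C) N∈
  ; leakInert = inj₂ (proj₂ (All.lookup initial N∈))
  ; history   = trans (proj₁ (All.lookup initial N∈)) (cong (_∷ []) (sym out₀))
  }

Tracks-input : ∀ {C k out n X} e → Tracks C k out n X → k < length (ln C) → StepInput C e k ≡ out n
Tracks-input {C} {k} e T k<n =
  trans (StepInput-neuron C e k<n) (trans (headOutputOf-just k (ln C) (found T)) (cong head0 (history T)))

Tracks-step : ∀ {C k out n X} e {a} → Tracks C k out n X → τ X ≤ a →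
  potential (w X) (StepInput C e) (length (ln C) + si C) ≡ gated (out (suc n)) a →
  Tracks (Step C e) k out (suc n) (NextNeuron X (StepInput C e) (length (ln C) + si C))
Tracks-step {C} {k} {out} {n} {X} e {a} T τ≤a potential≡ = record
  { found     = trans (findNeuron-map-NextNeuron k i L (ln C)) (cong (Maybe.map _) (found T))
  ; leakInert = subst (LeakInert (τ X)) (sym NextPot≡) (leakInert-gated τ≤a (out (suc n)))
  ; history   = cong₂ _∷_ (trans (cong (λ p → does (τ X ≤? p)) NextPot≡) (fires-gated X τ≤a _)) (history T)
  }
  where
  i : ℕ → Bool
  i = StepInput C e
  L : ℕ
  L = length (ln C) + si C
  NextPot≡ : NextPot X i L ≡ gated (out (suc n)) a
  NextPot≡ = trans (NextPot-leakInert X i L (leakInert T)) potential≡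

outputOf-Tracks : ∀ C N inp {k out n X} → id N ≡ k → Tracks (Run C inp) k out n X →
  outputOf C N inp ≡ applyDownFrom out (suc n)
outputOf-Tracks C N inp refl T = trans (outputOf-just C N inp (found T)) (history T)

NotGate : Neuron → Set
NotGate X = (w X 0 ≡ 0ℚ) × (w X 1 ≡ - w X 2) × (τ X ≤ w X 2)

CopyGate : Neuron → Set
CopyGate Y = (w Y 1 ≡ 0ℚ) × (w Y 2 ≡ 0ℚ) × (τ Y ≤ w Y 0)

gated-zero : ∀ b {a} → a ≡ 0ℚ → gated b a ≡ 0ℚ
gated-zero true  a≡0 = a≡0
gated-zero false _   = refl

potential-notGate : ∀ (v : ℕ → ℚ) i → v 0 ≡ 0ℚ → v 1 ≡ - v 2 → i 2 ≡ true →
  potential v i 3 ≡ gated (not (i 1)) (v 2)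
potential-notGate v i v₀≡0 v₁≡-v₂ i₂ = begin
  (0ℚ ℚ.+ gated (i 0) (v 0)) ℚ.+ gated (i 1) (v 1) ℚ.+ gated (i 2) (v 2)
    ≡⟨ cong₂ (λ x y → (0ℚ ℚ.+ x) ℚ.+ gated (i 1) (v 1) ℚ.+ y) (gated-zero (i 0) v₀≡0) (cong (λ b → gated b (v 2)) i₂) ⟩
  (0ℚ ℚ.+ 0ℚ) ℚ.+ gated (i 1) (v 1) ℚ.+ v 2
    ≡⟨ cong (ℚ._+ v 2) (+-identityˡ (gated (i 1) (v 1))) ⟩
  gated (i 1) (v 1) ℚ.+ v 2
    ≡⟨ inhibition (i 1) ⟩
  gated (not (i 1)) (v 2) ∎
  where
  open ≡-Reasoning
  inhibition : ∀ b → gated b (v 1) ℚ.+ v 2 ≡ gated (not b) (v 2)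
  inhibition true  = trans (cong (ℚ._+ v 2) v₁≡-v₂) (+-inverseˡ (v 2))
  inhibition false = +-identityˡ (v 2)

potential-copyGate : ∀ (v : ℕ → ℚ) i → v 1 ≡ 0ℚ → v 2 ≡ 0ℚ → potential v i 3 ≡ gated (i 0) (v 0)
potential-copyGate v i v₁≡0 v₂≡0 = begin
  (0ℚ ℚ.+ gated (i 0) (v 0)) ℚ.+ gated (i 1) (v 1) ℚ.+ gated (i 2) (v 2)
    ≡⟨ cong₂ (λ x y → (0ℚ ℚ.+ gated (i 0) (v 0)) ℚ.+ x ℚ.+ y) (gated-zero (i 1) v₁≡0) (gated-zero (i 2) v₂≡0) ⟩
  (0ℚ ℚ.+ gated (i 0) (v 0)) ℚ.+ 0ℚ ℚ.+ 0ℚ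
    ≡⟨ trans (+-identityʳ _) (trans (+-identityʳ _) (+-identityˡ _)) ⟩
  gated (i 0) (v 0) ∎
  where open ≡-Reasoning

loopUpdate : Bool × Bool → Bool × Bool
loopUpdate (a , b) = not b , a

loopOrbit : ℕ → Bool × Bool
loopOrbit zero    = false , false
loopOrbit (suc n) = loopUpdate (loopOrbit n)

loopUpdate-period : ∀ s → loopUpdate (loopUpdate (loopUpdate (loopUpdate s))) ≡ s
loopUpdate-period (a , b) rewrite not-involutive a | not-involutive b = refl

loopOrbit-mod : ∀ n → loopOrbit n ≡ loopOrbit (n % 4)
loopOrbit-mod 0 = refl
loopOrbit-mod 1 = refl
loopOrbit-mod 2 = refl
loopOrbit-mod 3 = refl
loopOrbit-mod (suc (suc (suc (suc n)))) = trans (loopUpdate-period (loopOrbit n)) (loopOrbit-mod n)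

pattern₀ pattern₁ : List Bool
pattern₀ = false ∷ true ∷ true ∷ false ∷ []
pattern₁ = false ∷ false ∷ true ∷ true ∷ []

loopOrbit-below4 : ∀ m (m<4 : m < 4) → loopOrbit m ≡ (lookup pattern₀ (fromℕ< m<4) , lookup pattern₁ (fromℕ< m<4))
loopOrbit-below4 0 _ = refl
loopOrbit-below4 1 _ = refl
loopOrbit-below4 2 _ = refl
loopOrbit-below4 3 _ = refl
loopOrbit-below4 (suc (suc (suc (suc m)))) (s≤s (s≤s (s≤s (s≤s ()))))

loopOrbit-cycle : ∀ n → loopOrbit n ≡ (lookup pattern₀ (n mod 4) , lookup pattern₁ (n mod 4))
loopOrbit-cycle n = trans (loopOrbit-mod n) (loopOrbit-below4 (n % 4) (m%n<n n 4))

applyDownFrom-cong : ∀ {A : Set} {f g : ℕ → A} → (∀ j → f j ≡ g j) → ∀ n → applyDownFrom f n ≡ applyDownFrom g n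
applyDownFrom-cong f≗g zero    = refl
applyDownFrom-cong f≗g (suc n) = cong₂ _∷_ (f≗g n) (applyDownFrom-cong f≗g n)

repeatPattern-applyDownFrom : ∀ x xs k →
  repeatPattern x xs k ≡ applyDownFrom (λ j → lookup (x ∷ xs) (j mod length (x ∷ xs))) k
repeatPattern-applyDownFrom x xs zero    = refl
repeatPattern-applyDownFrom x xs (suc k) = cong (lookup (x ∷ xs) (k mod length (x ∷ xs)) ∷_) (repeatPattern-applyDownFrom x xs k)

loopOrbit₀-repeatPattern : ∀ n → applyDownFrom (proj₁ ∘ loopOrbit) n ≡ repeatPattern false (true ∷ true ∷ false ∷ []) n
loopOrbit₀-repeatPattern n =
  trans (applyDownFrom-cong (cong proj₁ ∘ loopOrbit-cycle) n) (sym (repeatPattern-applyDownFrom false _ n))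

loopOrbit₁-repeatPattern : ∀ n → applyDownFrom (proj₂ ∘ loopOrbit) n ≡ repeatPattern false (false ∷ true ∷ true ∷ []) n
loopOrbit₁-repeatPattern n =
  trans (applyDownFrom-cong (cong proj₂ ∘ loopOrbit-cycle) n) (sym (repeatPattern-applyDownFrom false _ n))

record LoopInvariant (C : Circuit) (n : ℕ) : Set where
  field
    two-neurons : length (ln C) ≡ 2
    one-source  : si C ≡ 1
    neuron₀     : Neuron
    neuron₁     : Neuron
    notGate     : NotGate neuron₀
    copyGate    : CopyGate neuron₁
    tracks₀     : Tracks C 0 (proj₁ ∘ loopOrbit) n neuron₀
    tracks₁     : Tracks C 1 (proj₂ ∘ loopOrbit) n neuron₁

LoopInvariant-step : ∀ {C n} → LoopInvariant C n → LoopInvariant (Step C (λ _ → true)) (suc n)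
LoopInvariant-step {C} {n} I = record
  { two-neurons = trans (length-map _ (ln C)) two-neurons
  ; one-source  = one-source
  ; notGate     = notGate
  ; copyGate    = copyGate
  ; tracks₀     = Tracks-step e tracks₀ (proj₂ (proj₂ notGate)) potential₀
  ; tracks₁     = Tracks-step e tracks₁ (proj₂ (proj₂ copyGate)) potential₁
  }
  where
  open LoopInvariant I
  e : ℕ → Bool
  e _ = true
  i : ℕ → Bool
  i = StepInput C e
  L≡3 : length (ln C) + si C ≡ 3
  L≡3 = cong₂ _+_ two-neurons one-source
  i₀ : i 0 ≡ proj₁ (loopOrbit n)
  i₀ = Tracks-input e tracks₀ (subst (0 <_) (sym two-neurons) (s≤s z≤n))
  i₁ : i 1 ≡ proj₂ (loopOrbit n)
  i₁ = Tracks-input e tracks₁ (subst (1 <_) (sym two-neurons) (s≤s (s≤s z≤n)))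
  i₂ : i 2 ≡ true
  i₂ = StepInput-source C e (≤-reflexive two-neurons)
  potential₀ : potential (w neuron₀) i (length (ln C) + si C) ≡ gated (proj₁ (loopOrbit (suc n))) (w neuron₀ 2)
  potential₀ rewrite L≡3 = let (w₀ , w₁ , _) = notGate in
    trans (potential-notGate (w neuron₀) i w₀ w₁ i₂) (cong (λ b → gated (not b) (w neuron₀ 2)) i₁)
  potential₁ : potential (w neuron₁) i (length (ln C) + si C) ≡ gated (proj₂ (loopOrbit (suc n))) (w neuron₁ 0)
  potential₁ rewrite L≡3 = let (w₁ , w₂ , _) = copyGate in
    trans (potential-copyGate (w neuron₁) i w₁ w₂) (cong (λ b → gated b (w neuron₁ 0)) i₀)

LoopInvariant-run : ∀ {C} → LoopInvariant C 0 → ∀ {inp} → All (_≡ true) inp →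
  LoopInvariant (Run C (boolsToInputs inp)) (length inp)
LoopInvariant-run I []           = I
LoopInvariant-run I (refl ∷ all) = LoopInvariant-step (LoopInvariant-run I all)

proposition6p6 : (NC : Circuit) → IsInitialCircuit NC → NegativeLoop NC →
    (N₀ N₁ : Neuron) → N₀ ∈ ln NC → id N₀ ≡ 0 → N₁ ∈ ln NC → id N₁ ≡ 1 →
    τ N₀ ≤ w N₀ 2 → τ N₁ ≤ w N₁ 0 → w N₀ 1 ≡ - w N₀ 2 →
    (inp : List Bool) → All (_≡ true) inp →
    (outputOf NC N₀ (boolsToInputs inp) ≡ repeatPattern false (true ∷ true ∷ false ∷ []) (suc (length inp)))
    × (outputOf NC N₁ (boolsToInputs inp) ≡ repeatPattern false (false ∷ true ∷ true ∷ []) (suc (length inp)))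
proposition6p6 NC initial (si≡1 , length≡2 , _ , weights₁) N₀ N₁ N₀∈ id₀ N₁∈ id₁ τ₀≤w₀₂ τ₁≤w₁₀ w₀₁≡-w₀₂ inp allTrue =
  trans (outputOf-Tracks NC N₀ (boolsToInputs inp) id₀ tracks₀) (loopOrbit₀-repeatPattern (suc (length inp))) ,
  trans (outputOf-Tracks NC N₁ (boolsToInputs inp) id₁ tracks₁) (loopOrbit₁-repeatPattern (suc (length inp)))
  where
  selfWeight : ∀ N {k} → id N ≡ k → w N k ≡ 0ℚ
  selfWeight N refl = w-self N
  start : LoopInvariant NC 0
  start = record
    { two-neurons = length≡2
    ; one-source  = si≡1
    ; notGate     = selfWeight N₀ id₀ , w₀₁≡-w₀₂ , τ₀≤w₀₂
    ; copyGate    = selfWeight N₁ id₁ , proj₂ (All.lookup weights₁ N₁∈ id₁) , τ₁≤w₁₀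
    ; tracks₀     = Tracks-initial NC refl initial N₀∈ id₀
    ; tracks₁     = Tracks-initial NC refl initial N₁∈ id₁
    }
  open LoopInvariant (LoopInvariant-run start allTrue)
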